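{- Let $P$ be a finite set of atomic propositions, $T\in\mathbb{N}$, $\mathbb{T}=\{0,1,\dots,T\}$, and let $x:\mathbb{T}\to 2^P$ be a discrete-time signal. For every MTL formula $\varphi$ (built from the grammar given in the context, with closed time intervals $[a,b]$, $a,b\in\mathbb{N}$, $0\le a\le b$) and every $i\in\mathbb{T}$, the LTI-filtering value of $\varphi$ at $i$ equals $1$ if and only if $(x,i)\models_C\varphi$ in the classical semantics, i.e. $(x,i)\models_L\varphi \iff (x,i)\models_C\varphi$.
   Context: For $p\in P$, $x_p:\mathbb{T}\to\{0,1\}$ is the projection, $x_p[i]=1$ iff $p\in x[i]$. Formulas: $\varphi ::= p \mid \neg\varphi \mid \varphi_1\vee\varphi_2 \mid \varphi_1 U_I\varphi_2 \mid \varphi_1 S_I \varphi_2 \mid F_I\varphi\mid G_I\varphi\mid P_I\varphi\mid H_I\varphi$ (also $\wedge$, with $\varphi\wedge\psi=\neg(\neg\varphi\vee\neg\psi)$). Classical semantics $\models_C$: $(x,i)\models p$ iff $x_p[i]=1$; $\neg,\vee$ as usual; $(x,i)\models \varphi U_I\psi$ iff there is $j\in(i+I)\cap\mathbb{T}$ with $(x,j)\models\psi$ and $(x,k)\models\varphi$ for all integers $k$ with $i<k<j$; $(x,i)\models\varphi S_I\psi$ iff there is $j\in(i-I)\cap\mathbb{T}$ with $(x,j)\models\psi$ and $(x,k)\models\varphi$ for all integers $k$ with $j<k<i$; $(x,i)\models F_I\varphi$ iff $\exists j\in(i+I)\cap\mathbb{T}$ with $(x,j)\models\varphi$; $G_I\varphi$: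 for all $j\in(i+I)\cap\mathbb{T}$; $P_I\varphi$: $\exists j\in(i-I)\cap\mathbb{T}$; $H_I\varphi$: for all $j\in(i-I)\cap\mathbb{T}$. LTI-filtering semantics $\models_L$ (values in $\{0,1\}$, interpreting addition and multiplication in the max–min dioid): let $\delta$ be the Kronecker delta ($\delta(0)=1$, $\delta(n)=0$ otherwise), and for a closed integer interval $I$ (possibly empty, $[a,b]$ with $b<a$ being empty) define unnormalized windows $w^+_I[t]=\max_{k\in I}\delta(t+k)$ and $w^-_I[t]=\max_{k\in I}\delta(t-k)$ (identically $0$ if $I=\emptyset$). Then: $(x,i)\models_L p = x_p[i]$; $(x,i)\models_L\neg\varphi = 1-((x,i)\models_L\varphi)$; $(x,i)\models_L\varphi\vee\psi=\max$ of the two values; $(x,i)\models_L F_I\varphi=\max_{j\in\mathbb{T}}\min((x,j)\models_L\varphi,\,w^+_I[i-j])$; $(x,i)\models_L G_I\varphi = 1-((x,i)\models_L F_I\neg\varphi)$; $(x,i)\models_L P_I\varphi=\max_{j\in\mathbb{T}}\min((x,j)\models_L\varphi,\,w^-_I[i-j])$; $(x,i)\models_L H_I\varphi=1-((x,i)\models_L P_I\neg\varphi)$; $(x,i)\models_L\varphi U_I\psi=\max_{j\in I}\min((x,i)\models_L G_{[1,j-1]}\varphi,\ (x,i)\models_L F_{[j,j]}\psi)$; $(x,i)\models_L\varphi S_I\psi=\max_{j\in I}\min((x,i)\models_L H_{[1,j-1]}\varphi,\ (x,i)\models_L P_{[j,j]}\psi)$. "$(x,i)\models_L\varphi$" means this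 value is $1$. -}

module Defs where

open import Data.Nat using (ℕ; zero; suc; _+_; _∸_; _≤_; _<_)
open import Data.Integer as ℤ using (ℤ; +_; -[1+_])
open import Data.Fin using (Fin)
open import Data.Bool using (Bool; true; false; _∧_; _∨_; not)
open import Data.List using (List; map; upTo)
open import Data.Bool.ListAction using (any)
open import Data.Product using (Σ; _×_)
open import Data.Sum using (_⊎_)
open import Relation.Nullary using (¬_)
open import Relation.Binary.PropositionalEquality using (_≡_)

-- Signals over atomic propositions P = Fin n.
-- x : ℕ → Fin n → Bool ; x i p = true  iff  p ∈ x[i]  (i.e. x_p[i] = 1).
-- Only times i ∈ 𝕋 = {0,…,T} are ever inspected by either semantics.

Signal : ℕ → Set
Signal n = ℕ → Fin n → Bool

data Formula (n : ℕ) : Set where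
  atom : Fin n → Formula n
  ¬ᶠ_  : Formula n → Formula n
  _∨ᶠ_ : Formula n → Formula n → Formula n
  U[_,_]  : (a b : ℕ) → a ≤ b → Formula n → Formula n → Formula n
  S[_,_]  : (a b : ℕ) → a ≤ b → Formula n → Formula n → Formula n
  F[_,_]  : (a b : ℕ) → a ≤ b → Formula n → Formula n
  G[_,_]  : (a b : ℕ) → a ≤ b → Formula n → Formula n
  P[_,_]  : (a b : ℕ) → a ≤ b → Formula n → Formula n
  H[_,_]  : (a b : ℕ) → a ≤ b → Formula n → Formula n

_∧ᶠ_ : ∀ {n} → Formula n → Formula n → Formula n
φ ∧ᶠ ψ = ¬ᶠ ((¬ᶠ φ) ∨ᶠ (¬ᶠ ψ))

module Classical (T : ℕ) {n : ℕ} (x : Signal n) where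

  _⊨_ : ℕ → Formula n → Set
  i ⊨ atom p = x i p ≡ true
  i ⊨ (¬ᶠ φ) = ¬ (i ⊨ φ)
  i ⊨ (φ ∨ᶠ ψ) = (i ⊨ φ) ⊎ (i ⊨ ψ)
  i ⊨ U[ a , b ] _ φ ψ =
    Σ ℕ λ j → (i + a ≤ j × j ≤ i + b × j ≤ T) × (j ⊨ ψ)
              × (∀ k → i < k → k < j → k ⊨ φ)
  -- j ∈ (i - [a,b]) ∩ 𝕋 , i.e. j + a ≤ i ≤ j + b (j ≥ 0 automatic)
  i ⊨ S[ a , b ] _ φ ψ =
    Σ ℕ λ j → (j + a ≤ i × i ≤ j + b × j ≤ T) × (j ⊨ ψ)
              × (∀ k → j < k → k < i → k ⊨ φ)
  i ⊨ F[ a , b ] _ φ = Σ ℕ λ j → (i + a ≤ j × j ≤ i + b × j ≤ T) × (j ⊨ φ)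
  i ⊨ G[ a , b ] _ φ = ∀ j → i + a ≤ j → j ≤ i + b → j ≤ T → j ⊨ φ
  i ⊨ P[ a , b ] _ φ = Σ ℕ λ j → (j + a ≤ i × i ≤ j + b × j ≤ T) × (j ⊨ φ)
  i ⊨ H[ a , b ] _ φ = ∀ j → j + a ≤ i → i ≤ j + b → j ≤ T → j ⊨ φ

-- LTI-filtering semantics in the max–min dioid on {0,1} (= Bool,
-- max = _∨_, min = _∧_, 1 - v = not v).

-- the list of integers k with a ≤ k ≤ b (empty if b < a)
range : ℕ → ℕ → List ℕ
range a b = map (λ k → a + k) (upTo (suc b ∸ a))

maxOver : ℕ → ℕ → (ℕ → Bool) → Bool
maxOver a b f = any f (range a b)

δ : ℤ → Bool
δ (+ zero) = true
δ (+ suc _) = false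
δ -[1+ _ ] = false

w⁺ : ℕ → ℕ → ℤ → Bool
w⁺ a b t = maxOver a b (λ k → δ (t ℤ.+ + k))

w⁻ : ℕ → ℕ → ℤ → Bool
w⁻ a b t = maxOver a b (λ k → δ (t ℤ.- + k))

module LTI (T : ℕ) where

  LF : ℕ → ℕ → (ℕ → Bool) → ℕ → Bool
  LF a b v i = maxOver 0 T (λ j → v j ∧ w⁺ a b (+ i ℤ.- + j))

  LG : ℕ → ℕ → (ℕ → Bool) → ℕ → Bool
  LG a b v i = not (LF a b (λ j → not (v j)) i)

  LP : ℕ → ℕ → (ℕ → Bool) → ℕ → Bool
  LP a b v i = maxOver 0 T (λ j → v j ∧ w⁻ a b (+ i ℤ.- + j))

  LH : ℕ → ℕ → (ℕ → Bool) → ℕ → Bool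
  LH a b v i = not (LP a b (λ j → not (v j)) i)

  -- [1, j-1] : for j = 0 the natural-number subtraction gives [1,0],
  -- which is empty, as is the integer interval [1,-1].
  LU : ℕ → ℕ → (ℕ → Bool) → (ℕ → Bool) → ℕ → Bool
  LU a b u v i = maxOver a b (λ j → LG 1 (j ∸ 1) u i ∧ LF j j v i)

  LS : ℕ → ℕ → (ℕ → Bool) → (ℕ → Bool) → ℕ → Bool
  LS a b u v i = maxOver a b (λ j → LH 1 (j ∸ 1) u i ∧ LP j j v i)

  ⟦_⟧ : ∀ {n} → Formula n → Signal n → ℕ → Bool
  ⟦ atom p ⟧ x i = x i p
  ⟦ ¬ᶠ φ ⟧ x i = not (⟦ φ ⟧ x i)
  ⟦ φ ∨ᶠ ψ ⟧ x i = ⟦ φ ⟧ x i ∨ ⟦ ψ ⟧ x i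
  ⟦ U[ a , b ] _ φ ψ ⟧ x i = LU a b (⟦ φ ⟧ x) (⟦ ψ ⟧ x) i
  ⟦ S[ a , b ] _ φ ψ ⟧ x i = LS a b (⟦ φ ⟧ x) (⟦ ψ ⟧ x) i
  ⟦ F[ a , b ] _ φ ⟧ x i = LF a b (⟦ φ ⟧ x) i
  ⟦ G[ a , b ] _ φ ⟧ x i = LG a b (⟦ φ ⟧ x) i
  ⟦ P[ a , b ] _ φ ⟧ x i = LP a b (⟦ φ ⟧ x) i
  ⟦ H[ a , b ] _ φ ⟧ x i = LH a b (⟦ φ ⟧ x) i

-- A max–min convolution with the window w⁺ [a,b] (resp. w⁻ [a,b]) is 1 at
-- time i exactly when its argument is 1 at some time j of 𝕋 with
-- j ∈ i + [a,b] (resp. j ∈ i - [a,b]), because δ fires at the single shift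
-- k = j - i (resp. i - j). So the filters F and P are the classical
-- operators, G and H are their duals, and U and S decompose by the time j of
-- the witness: F [j,j] checks that witness and G [1,j-1] (resp. H [1,j-1])
-- checks the strictly intermediate times. Induction on the formula finishes,
-- with the classical meaning of a subformula carried along as a predicate
-- that the Boolean value decides on 𝕋.
module Submission where

open import Defs
open import Data.Nat using (ℕ; zero; suc; _+_; _∸_; _≤_; _<_; z≤n; s≤s; s≤s⁻¹)
open import Data.Nat.Properties
  using (≤-reflexive; ≤-trans; ≤-antisym; <⇒≤; <⇒≱; <-asym;
         +-suc; +-comm; +-identityʳ; m≤m+n; +-monoʳ-≤; +-monoˡ-≤; +-cancelˡ-≤; +-cancelʳ-≤;
         m+[n∸m]≡n)
open import Data.Integer as ℤ using (ℤ; +_; -[1+_]; 0ℤ)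
import Data.Integer.Properties as ℤ
open import Data.Bool using (Bool; true; false; _∧_; _∨_; not)
import Data.Bool.Properties as Bool
open import Data.Bool.ListAction using (any)
open import Data.List using (List; []; _∷_)
open import Data.List.Membership.Propositional using (_∈_)
open import Data.List.Membership.Propositional.Properties using (∈-map⁻; ∈-map⁺; ∈-upTo⁻; ∈-upTo⁺)
open import Data.List.Relation.Unary.Any using (here; there)
open import Data.Product using (∃-syntax; _×_; _,_)
open import Data.Sum using (_⊎_; inj₁; inj₂)
open import Data.Sum.Function.Propositional using (_⊎-⇔_)
open import Data.Empty using (⊥-elim)
open import Function using (_∘_; case_of_)
open import Function.Bundles using (_⇔_; mk⇔; Equivalence)
open import Function.Construct.Identity using (⇔-id)
open import Function.Construct.Composition using (_⇔-∘_)
open import Relation.Nullary using (¬_)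
open import Relation.Nullary.Decidable using (decidable-stable)
import Relation.Nullary.Decidable as Dec
open import Relation.Binary.PropositionalEquality using (_≡_; refl; sym; cong; subst; module ≡-Reasoning)

open Equivalence

private
  variable
    a b i j k m n : ℕ
    x y : Bool
    f : ℕ → Bool
    xs : List ℕ
    z : ℤ

∧-true : x ∧ y ≡ true ⇔ (x ≡ true × y ≡ true)
∧-true {true}  {true}  = mk⇔ (λ _ → refl , refl) (λ _ → refl)
∧-true {true}  {false} = mk⇔ (λ ()) (λ ())
∧-true {false}         = mk⇔ (λ ()) (λ ())

∨-true : x ∨ y ≡ true ⇔ (x ≡ true ⊎ y ≡ true)
∨-true {true}          = mk⇔ (λ _ → inj₁ refl) (λ _ → refl)
∨-true {false} {true}  = mk⇔ (λ _ → inj₂ refl) (λ _ → refl)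
∨-true {false} {false} = mk⇔ (λ ()) (λ { (inj₁ ()) ; (inj₂ ()) })

not-true : not x ≡ true ⇔ (¬ x ≡ true)
not-true {true}  = mk⇔ (λ ()) (λ ¬x → ⊥-elim (¬x refl))
not-true {false} = mk⇔ (λ _ ()) (λ _ → refl)

any-true : any f xs ≡ true ⇔ (∃[ y ] (y ∈ xs × f y ≡ true))
any-true {f} {[]} = mk⇔ (λ ()) (λ { (_ , () , _) })
any-true {f} {y ∷ xs} = mk⇔ to′ from′
  where
  to′ : f y ∨ any f xs ≡ true → ∃[ z ] (z ∈ y ∷ xs × f z ≡ true)
  to′ p with to (∨-true {f y}) p
  ... | inj₁ fy = y , here refl , fy
  ... | inj₂ rest with to (any-true {f} {xs}) rest
  ...   | z , z∈xs , fz = z , there z∈xs , fz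
  from′ : ∃[ z ] (z ∈ y ∷ xs × f z ≡ true) → f y ∨ any f xs ≡ true
  from′ (_ , here refl , fy)  = from ∨-true (inj₁ fy)
  from′ (z , there z∈xs , fz) = from (∨-true {f y}) (inj₂ (from any-true (z , z∈xs , fz)))

<∸⇔+< : ∀ a m k → k < m ∸ a ⇔ a + k < m
<∸⇔+< zero    m       k = ⇔-id _
<∸⇔+< (suc a) zero    k = mk⇔ (λ ()) (λ ())
<∸⇔+< (suc a) (suc m) k = mk⇔ (s≤s ∘ to (<∸⇔+< a m k)) (from (<∸⇔+< a m k) ∘ s≤s⁻¹)

∈-range : k ∈ range a b ⇔ (a ≤ k × k ≤ b)
∈-range {k} {a} {b} = mk⇔ to′ from′
  where
  to′ : k ∈ range a b → a ≤ k × k ≤ b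
  to′ k∈ with ∈-map⁻ (λ d → a + d) k∈
  ... | d , d∈ , refl = m≤m+n a d , s≤s⁻¹ (to (<∸⇔+< a (suc b) d) (∈-upTo⁻ d∈))
  from′ : a ≤ k × k ≤ b → k ∈ range a b
  from′ (a≤k , k≤b) = subst (_∈ range a b) a+d≡k (∈-map⁺ (λ d → a + d) (∈-upTo⁺ d<len))
    where
    a+d≡k : a + (k ∸ a) ≡ k
    a+d≡k = m+[n∸m]≡n a≤k
    d<len : k ∸ a < suc b ∸ a
    d<len = from (<∸⇔+< a (suc b) (k ∸ a)) (s≤s (≤-trans (≤-reflexive a+d≡k) k≤b))

maxOver-true : ∀ a b f → maxOver a b f ≡ true ⇔ (∃[ k ] (a ≤ k × k ≤ b × f k ≡ true))
maxOver-true a b f = mk⇔ to′ from′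
  where
  to′ : maxOver a b f ≡ true → ∃[ k ] (a ≤ k × k ≤ b × f k ≡ true)
  to′ p with to any-true p
  ... | k , k∈ , fk with to ∈-range k∈
  ...   | a≤k , k≤b = k , a≤k , k≤b , fk
  from′ : ∃[ k ] (a ≤ k × k ≤ b × f k ≡ true) → maxOver a b f ≡ true
  from′ (k , a≤k , k≤b , fk) = from any-true (k , from ∈-range (a≤k , k≤b) , fk)

offset-in-range : (∃[ k ] (a ≤ k × k ≤ b × m + k ≡ n)) ⇔ (m + a ≤ n × n ≤ m + b)
offset-in-range {a} {b} {m} {n} = mk⇔ to′ from′
  where
  to′ : ∃[ k ] (a ≤ k × k ≤ b × m + k ≡ n) → m + a ≤ n × n ≤ m + b
  to′ (k , a≤k , k≤b , refl) = +-monoʳ-≤ m a≤k , +-monoʳ-≤ m k≤b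
  from′ : m + a ≤ n × n ≤ m + b → ∃[ k ] (a ≤ k × k ≤ b × m + k ≡ n)
  from′ (l , r) =
      n ∸ m
    , +-cancelˡ-≤ m a (n ∸ m) (≤-trans l (≤-reflexive (sym m+d≡n)))
    , +-cancelˡ-≤ m (n ∸ m) b (≤-trans (≤-reflexive m+d≡n) r)
    , m+d≡n
    where
    m+d≡n : m + (n ∸ m) ≡ n
    m+d≡n = m+[n∸m]≡n (≤-trans (m≤m+n m a) l)

maxOver-offset : ∀ a b m n {f} → (∀ k → f k ≡ true ⇔ m + k ≡ n) →
                 maxOver a b f ≡ true ⇔ (m + a ≤ n × n ≤ m + b)
maxOver-offset a b m n {f} hf = mk⇔
  (λ p → case to (maxOver-true a b f) p of λ
     { (k , a≤k , k≤b , fk) → to offset-in-range (k , a≤k , k≤b , to (hf k) fk) })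
  (λ lr → case from offset-in-range lr of λ
     { (k , a≤k , k≤b , e) → from (maxOver-true a b f) (k , a≤k , k≤b , from (hf k) e) })

δ-true : δ z ≡ true ⇔ z ≡ 0ℤ
δ-true {+ zero}  = mk⇔ (λ _ → refl) (λ _ → refl)
δ-true {+ suc _} = mk⇔ (λ ()) (λ ())
δ-true { -[1+ _ ] } = mk⇔ (λ ()) (λ ())

δ-difference-true : δ (+ m ℤ.- + n) ≡ true ⇔ m ≡ n
δ-difference-true {m} {n} = mk⇔
  (ℤ.+-injective ∘ ℤ.i-j≡0⇒i≡j (+ m) (+ n) ∘ to δ-true)
  (from δ-true ∘ ℤ.i≡j⇒i-j≡0 ∘ cong (λ d → + d))

[i-j]+k≡[i+k]-j : ∀ i j k → (+ i ℤ.- + j) ℤ.+ + k ≡ + (i + k) ℤ.- + j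
[i-j]+k≡[i+k]-j i j k = begin
  (+ i ℤ.- + j) ℤ.+ + k      ≡⟨ ℤ.+-assoc (+ i) (ℤ.- + j) (+ k) ⟩
  + i ℤ.+ (ℤ.- + j ℤ.+ + k)  ≡⟨ cong (ℤ._+_ (+ i)) (ℤ.+-comm (ℤ.- + j) (+ k)) ⟩
  + i ℤ.+ (+ k ℤ.- + j)      ≡⟨ ℤ.+-assoc (+ i) (+ k) (ℤ.- + j) ⟨
  (+ i ℤ.+ + k) ℤ.- + j      ≡⟨ cong (ℤ._- + j) (ℤ.pos-+ i k) ⟨
  + (i + k) ℤ.- + j          ∎
  where open ≡-Reasoning

[i-j]-k≡i-[j+k] : ∀ i j k → (+ i ℤ.- + j) ℤ.- + k ≡ + i ℤ.- + (j + k)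
[i-j]-k≡i-[j+k] i j k = begin
  (+ i ℤ.- + j) ℤ.- + k          ≡⟨ ℤ.+-assoc (+ i) (ℤ.- + j) (ℤ.- + k) ⟩
  + i ℤ.+ (ℤ.- + j ℤ.- + k)      ≡⟨ cong (ℤ._+_ (+ i)) (ℤ.neg-distrib-+ (+ j) (+ k)) ⟨
  + i ℤ.- (+ j ℤ.+ + k)          ≡⟨ cong (λ d → + i ℤ.- d) (ℤ.pos-+ j k) ⟨
  + i ℤ.- + (j + k)              ∎
  where open ≡-Reasoning

w⁺-true : ∀ a b i j → w⁺ a b (+ i ℤ.- + j) ≡ true ⇔ (i + a ≤ j × j ≤ i + b)
w⁺-true a b i j = maxOver-offset a b i j λ k → mk⇔
  (to δ-difference-true ∘ subst (λ d → δ d ≡ true) ([i-j]+k≡[i+k]-j i j k))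
  (subst (λ d → δ d ≡ true) (sym ([i-j]+k≡[i+k]-j i j k)) ∘ from δ-difference-true)

w⁻-true : ∀ a b i j → w⁻ a b (+ i ℤ.- + j) ≡ true ⇔ (j + a ≤ i × i ≤ j + b)
w⁻-true a b i j = maxOver-offset a b j i λ k → mk⇔
  (sym ∘ to δ-difference-true ∘ subst (λ d → δ d ≡ true) ([i-j]-k≡i-[j+k] i j k))
  (subst (λ d → δ d ≡ true) (sym ([i-j]-k≡i-[j+k] i j k)) ∘ from δ-difference-true ∘ sym)

<⇔+1≤ : i < m ⇔ i + 1 ≤ m
<⇔+1≤ {i} {m} = mk⇔
  (λ i<m → ≤-trans (≤-reflexive (+-comm i 1)) i<m)
  (λ i+1≤m → ≤-trans (≤-reflexive (+-comm 1 i)) i+1≤m)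

-- For k = 0 the truncated k ∸ 1 is 0, and both sides are false (here and in +≤+∸1⇔<).
<+⇔≤+∸1 : n < m → (m < n + k ⇔ m ≤ n + (k ∸ 1))
<+⇔≤+∸1 {n} {m} {zero} n<m = mk⇔
  (λ m<n+0 → ⊥-elim (<-asym n<m (subst (m <_) (+-identityʳ n) m<n+0)))
  (λ m≤n+0 → ⊥-elim (<⇒≱ n<m (subst (m ≤_) (+-identityʳ n) m≤n+0)))
<+⇔≤+∸1 {n} {m} {suc k} _ = mk⇔
  (s≤s⁻¹ ∘ subst (m <_) (+-suc n k))
  (subst (m <_) (sym (+-suc n k)) ∘ s≤s)

+≤+∸1⇔< : m < j + k → (j + k ≤ m + (k ∸ 1) ⇔ j < m)
+≤+∸1⇔< {m} {j} {zero} m<j+0 = mk⇔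
  (λ j+0≤m+0 → ⊥-elim (<⇒≱ m<j+0 (subst (j + 0 ≤_) (+-identityʳ m) j+0≤m+0)))
  (λ j<m → ⊥-elim (<-asym j<m (subst (m <_) (+-identityʳ j) m<j+0)))
+≤+∸1⇔< {m} {j} {suc k} _ = mk⇔
  (+-cancelʳ-≤ k (suc j) m ∘ subst (_≤ m + k) (+-suc j k))
  (subst (_≤ m + k) (sym (+-suc j k)) ∘ +-monoˡ-≤ k)

module Correspondence (T : ℕ) where
  open LTI T

  _Decides_ : (ℕ → Bool) → (ℕ → Set) → Set
  v Decides Q = ∀ j → j ≤ T → v j ≡ true ⇔ Q j

  private
    variable
      u v w : ℕ → Bool
      Q R A B : ℕ → Set

  not-decides : v Decides Q → (λ j → not (v j)) Decides (λ j → ¬ Q j)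
  not-decides h j j≤T = mk⇔
    (λ ¬vj qj → to not-true ¬vj (from (h j j≤T) qj))
    (λ ¬qj → from not-true (¬qj ∘ to (h j j≤T)))

  ∨-decides : u Decides Q → v Decides R → (λ j → u j ∨ v j) Decides (λ j → Q j ⊎ R j)
  ∨-decides hu hv j j≤T = (hu j j≤T ⊎-⇔ hv j j≤T) ⇔-∘ ∨-true

  filter-true : v Decides Q → (∀ j → w j ≡ true ⇔ (A j × B j)) →
                maxOver 0 T (λ j → v j ∧ w j) ≡ true ⇔ (∃[ j ] ((A j × B j × j ≤ T) × Q j))
  filter-true {v} {Q} {w} {A} {B} h hw = mk⇔ to′ from′
    where
    to′ : maxOver 0 T (λ j → v j ∧ w j) ≡ true → ∃[ j ] ((A j × B j × j ≤ T) × Q j)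
    to′ p with to (maxOver-true 0 T _) p
    ... | j , _ , j≤T , vw with to (∧-true {v j}) vw
    ...   | vj , wj with to (hw j) wj
    ...     | aj , bj = j , (aj , bj , j≤T) , to (h j j≤T) vj
    from′ : ∃[ j ] ((A j × B j × j ≤ T) × Q j) → maxOver 0 T (λ j → v j ∧ w j) ≡ true
    from′ (j , (aj , bj , j≤T) , qj) =
      from (maxOver-true 0 T _)
        (j , z≤n , j≤T , from ∧-true (from (h j j≤T) qj , from (hw j) (aj , bj)))

  -- Constructively, ¬ ∃ ¬ only gives ∀ because Q is decided by v on 𝕋.
  co-filter-true : v Decides Q → (∀ j → w j ≡ true ⇔ (A j × B j)) →
                   not (maxOver 0 T (λ j → not (v j) ∧ w j)) ≡ true ⇔
                   (∀ j → A j → B j → j ≤ T → Q j)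
  co-filter-true {v} {Q} {w} {A} {B} h hw = mk⇔ to′ from′
    where
    counterexample : maxOver 0 T (λ j → not (v j) ∧ w j) ≡ true ⇔
                     (∃[ j ] ((A j × B j × j ≤ T) × ¬ Q j))
    counterexample = filter-true (not-decides h) hw
    to′ : not (maxOver 0 T (λ j → not (v j) ∧ w j)) ≡ true →
          ∀ j → A j → B j → j ≤ T → Q j
    to′ p j aj bj j≤T = decidable-stable (Dec.map (h j j≤T) (v j Bool.≟ true))
      λ ¬qj → to not-true p (from counterexample (j , (aj , bj , j≤T) , ¬qj))
    from′ : (∀ j → A j → B j → j ≤ T → Q j) →
            not (maxOver 0 T (λ j → not (v j) ∧ w j)) ≡ true
    from′ all = from not-true λ p →
      let (j , (aj , bj , j≤T) , ¬qj) = to counterexample p in ¬qj (all j aj bj j≤T)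

  LF-true : v Decides Q →
            LF a b v i ≡ true ⇔ (∃[ j ] ((i + a ≤ j × j ≤ i + b × j ≤ T) × Q j))
  LF-true {a = a} {b} {i} h = filter-true h (w⁺-true a b i)

  LP-true : v Decides Q →
            LP a b v i ≡ true ⇔ (∃[ j ] ((j + a ≤ i × i ≤ j + b × j ≤ T) × Q j))
  LP-true {a = a} {b} {i} h = filter-true h (w⁻-true a b i)

  LG-true : v Decides Q →
            LG a b v i ≡ true ⇔ (∀ j → i + a ≤ j → j ≤ i + b → j ≤ T → Q j)
  LG-true {a = a} {b} {i} h = co-filter-true h (w⁺-true a b i)

  LH-true : v Decides Q →
            LH a b v i ≡ true ⇔ (∀ j → j + a ≤ i → i ≤ j + b → j ≤ T → Q j)
  LH-true {a = a} {b} {i} h = co-filter-true h (w⁻-true a b i)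

  LF-point : v Decides Q → LF k k v i ≡ true ⇔ (∃[ j ] (i + k ≡ j × j ≤ T × Q j))
  LF-point {v} {Q} {k} {i} h = mk⇔
    (λ p → let (j , (l , r , j≤T) , qj) = to window p in j , ≤-antisym l r , j≤T , qj)
    (λ (j , e , j≤T , qj) → from window (j , (≤-reflexive e , ≤-reflexive (sym e) , j≤T) , qj))
    where
    window : LF k k v i ≡ true ⇔ (∃[ j ] ((i + k ≤ j × j ≤ i + k × j ≤ T) × Q j))
    window = LF-true {a = k} {b = k} {i = i} h

  LP-point : v Decides Q → LP k k v i ≡ true ⇔ (∃[ j ] (j + k ≡ i × j ≤ T × Q j))
  LP-point {v} {Q} {k} {i} h = mk⇔
    (λ p → let (j , (l , r , j≤T) , qj) = to window p in j , ≤-antisym l r , j≤T , qj)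
    (λ (j , e , j≤T , qj) → from window (j , (≤-reflexive e , ≤-reflexive (sym e) , j≤T) , qj))
    where
    window : LP k k v i ≡ true ⇔ (∃[ j ] ((j + k ≤ i × i ≤ j + k × j ≤ T) × Q j))
    window = LP-true {a = k} {b = k} {i = i} h

  LG-between : u Decides Q → i + k ≡ j → j ≤ T →
               LG 1 (k ∸ 1) u i ≡ true ⇔ (∀ m → i < m → m < j → Q m)
  LG-between {u} {Q} {i} {k} h refl j≤T = mk⇔
    (λ g m i<m m<j →
       to window g m (to <⇔+1≤ i<m) (to (<+⇔≤+∸1 i<m) m<j) (≤-trans (<⇒≤ m<j) j≤T))
    (λ all → from window λ m i+1≤m m≤ _ →
       let i<m = from <⇔+1≤ i+1≤m in all m i<m (from (<+⇔≤+∸1 i<m) m≤))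
    where
    window : LG 1 (k ∸ 1) u i ≡ true ⇔
             (∀ m → i + 1 ≤ m → m ≤ i + (k ∸ 1) → m ≤ T → Q m)
    window = LG-true {a = 1} {b = k ∸ 1} {i = i} h

  LH-between : u Decides Q → j + k ≡ i → i ≤ T →
               LH 1 (k ∸ 1) u i ≡ true ⇔ (∀ m → j < m → m < i → Q m)
  LH-between {u} {Q} {j} {k} h refl i≤T = mk⇔
    (λ g m j<m m<i →
       to window g m (to <⇔+1≤ m<i) (from (+≤+∸1⇔< m<i) j<m) (≤-trans (<⇒≤ m<i) i≤T))
    (λ all → from window λ m m+1≤i ≤m _ →
       let m<i = from <⇔+1≤ m+1≤i in all m (to (+≤+∸1⇔< m<i) ≤m) m<i)
    where
    window : LH 1 (k ∸ 1) u (j + k) ≡ true ⇔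
             (∀ m → m + 1 ≤ j + k → j + k ≤ m + (k ∸ 1) → m ≤ T → Q m)
    window = LH-true {a = 1} {b = k ∸ 1} {i = j + k} h

  Until : (ℕ → Set) → (ℕ → Set) → ℕ → ℕ → ℕ → Set
  Until Q R a b i =
    ∃[ j ] ((i + a ≤ j × j ≤ i + b × j ≤ T) × R j × (∀ m → i < m → m < j → Q m))

  Since : (ℕ → Set) → (ℕ → Set) → ℕ → ℕ → ℕ → Set
  Since Q R a b i =
    ∃[ j ] ((j + a ≤ i × i ≤ j + b × j ≤ T) × R j × (∀ m → j < m → m < i → Q m))

  LU-true : u Decides Q → v Decides R → LU a b u v i ≡ true ⇔ Until Q R a b i
  LU-true {u} {Q} {v} {R} {a} {b} {i} hu hv = mk⇔ to′ from′
    where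
    to′ : LU a b u v i ≡ true → Until Q R a b i
    to′ p with to (maxOver-true a b _) p
    ... | k , a≤k , k≤b , gf with to (∧-true {LG 1 (k ∸ 1) u i}) gf
    ...   | g , f with to (LF-point {k = k} {i = i} hv) f
    ...     | j , i+k≡j , j≤T , rj with to offset-in-range (k , a≤k , k≤b , i+k≡j)
    ...       | l , r = j , (l , r , j≤T) , rj , to (LG-between hu i+k≡j j≤T) g
    from′ : Until Q R a b i → LU a b u v i ≡ true
    from′ (j , (l , r , j≤T) , rj , between) with from offset-in-range (l , r)
    ... | k , a≤k , k≤b , i+k≡j = from (maxOver-true a b _) (k , a≤k , k≤b , from ∧-true
      ( from (LG-between hu i+k≡j j≤T) between
      , from (LF-point {k = k} {i = i} hv) (j , i+k≡j , j≤T , rj)))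

  LS-true : u Decides Q → v Decides R → i ≤ T → LS a b u v i ≡ true ⇔ Since Q R a b i
  LS-true {u} {Q} {v} {R} {i} {a} {b} hu hv i≤T = mk⇔ to′ from′
    where
    to′ : LS a b u v i ≡ true → Since Q R a b i
    to′ p with to (maxOver-true a b _) p
    ... | k , a≤k , k≤b , gf with to (∧-true {LH 1 (k ∸ 1) u i}) gf
    ...   | g , f with to (LP-point {k = k} {i = i} hv) f
    ...     | j , j+k≡i , j≤T , rj with to offset-in-range (k , a≤k , k≤b , j+k≡i)
    ...       | l , r = j , (l , r , j≤T) , rj , to (LH-between hu j+k≡i i≤T) g
    from′ : Since Q R a b i → LS a b u v i ≡ true
    from′ (j , (l , r , j≤T) , rj , between) with from offset-in-range (l , r)
    ... | k , a≤k , k≤b , j+k≡i = from (maxOver-true a b _) (k , a≤k , k≤b , from ∧-true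
      ( from (LH-between hu j+k≡i i≤T) between
      , from (LP-point {k = k} {i = i} hv) (j , j+k≡i , j≤T , rj)))

  module _ {n : ℕ} (x : Signal n) where
    open Classical T x

    ⟦⟧-decides : (φ : Formula n) → ⟦ φ ⟧ x Decides (_⊨ φ)
    ⟦⟧-decides (atom p)                  = λ _ _ → ⇔-id _
    ⟦⟧-decides (¬ᶠ φ)                    = not-decides (⟦⟧-decides φ)
    ⟦⟧-decides (φ ∨ᶠ ψ)                  = ∨-decides (⟦⟧-decides φ) (⟦⟧-decides ψ)
    ⟦⟧-decides (U[ a , b ] _ φ ψ) i _   = LU-true (⟦⟧-decides φ) (⟦⟧-decides ψ)
    ⟦⟧-decides (S[ a , b ] _ φ ψ) i i≤T = LS-true (⟦⟧-decides φ) (⟦⟧-decides ψ) i≤T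
    ⟦⟧-decides (F[ a , b ] _ φ) i _     = LF-true {a = a} {b = b} {i = i} (⟦⟧-decides φ)
    ⟦⟧-decides (G[ a , b ] _ φ) i _     = LG-true {a = a} {b = b} {i = i} (⟦⟧-decides φ)
    ⟦⟧-decides (P[ a , b ] _ φ) i _     = LP-true {a = a} {b = b} {i = i} (⟦⟧-decides φ)
    ⟦⟧-decides (H[ a , b ] _ φ) i _     = LH-true {a = a} {b = b} {i = i} (⟦⟧-decides φ)

theorem1 : (n T : ℕ) (x : Signal n) (φ : Formula n) (i : ℕ) → i ≤ T →
           (LTI.⟦_⟧ T φ x i ≡ true) ⇔ Classical._⊨_ T x i φ
theorem1 n T x φ = Correspondence.⟦⟧-decides T x φ
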